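{- For every permutation $w$, no element of the interval poset $\mathcal{P}(w)$ covers exactly three elements.
   Context: For $w \in \mathfrak{S}_n$ in one-line notation $w(1)\cdots w(n)$, an interval of $w$ is a set of consecutive integers $[h,h+j]$ with $\{w(t) : t \in [i,i+j]\} = [h,h+j]$ for some $i$. The interval poset $\mathcal{P}(w)$ is the set of nonempty intervals of $w$ ordered by inclusion. -}

module Defs where

open import Data.Nat using (ℕ; _+_; _≤_; _<_)
open import Data.Fin using (Fin; toℕ)
open import Data.Fin.Permutation using (Permutation′; _⟨$⟩ʳ_)
open import Data.Product using (Σ; ∃; _×_; _,_)
open import Data.Sum using (_⊎_)
open import Relation.Nullary using (¬_)
open import Relation.Binary.PropositionalEquality using (_≡_; _≢_)
open import Function.Bundles using (_⇔_)

-- A (nonempty) set of consecutive integers [h, h+j] is encoded by the pair (h , j).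
-- Positions and values of w ∈ 𝔖_n are 0-indexed: w(t) = toℕ (w ⟨$⟩ʳ t), t ∈ Fin n.
Seg : Set
Seg = ℕ × ℕ

_∈Seg_ : ℕ → Seg → Set
x ∈Seg (h , j) = h ≤ x × x ≤ h + j

IsInterval : ∀ {n} → Permutation′ n → Seg → Set
IsInterval {n} w (h , j) =
  Σ ℕ λ i → (i + j < n) ×
    (∀ v → (v ∈Seg (h , j)) ⇔
           (Σ (Fin n) λ t → (toℕ t ∈Seg (i , j)) × (toℕ (w ⟨$⟩ʳ t) ≡ v)))

_⊆Seg_ : Seg → Seg → Set
J ⊆Seg I = ∀ x → x ∈Seg J → x ∈Seg I

_⊂Seg_ : Seg → Seg → Set
J ⊂Seg I = (J ⊆Seg I) × ¬ (I ⊆Seg J)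

Covers : ∀ {n} → Permutation′ n → Seg → Seg → Set
Covers w I J =
  IsInterval w J × (J ⊂Seg I) ×
  ¬ (Σ Seg λ K → IsInterval w K × (J ⊂Seg K) × (K ⊂Seg I))

CoversExactlyThree : ∀ {n} → Permutation′ n → Seg → Set
CoversExactlyThree w I =
  Σ Seg λ J₁ → Σ Seg λ J₂ → Σ Seg λ J₃ →
    Covers w I J₁ × Covers w I J₂ × Covers w I J₃ ×
    (J₁ ≢ J₂) × (J₁ ≢ J₃) × (J₂ ≢ J₃) ×
    (∀ J → Covers w I J → (J ≡ J₁) ⊎ (J ≡ J₂) ⊎ (J ≡ J₃))

module Submission where

-- Two covers of I whose union is again an interval must together fill I, since that
-- union lies strictly between either of them and I. Suppose I covered exactly J₁, J₂, J₃.
-- Every point of I lies in a cover (one above its singleton) and no cover contains both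
-- endpoints of I, so the endpoints lie in different covers L and R, and the third cover M
-- meets neither; hence L < M < R fill the values of I without gaps. As M is shorter than
-- I, some position of I abuts the positions of M; its value lies in L or R, and the union
-- of that cover with M is an interval which, missing an endpoint of I, is strictly smaller
-- than I.

open import Defs
open import Data.Nat using (ℕ; suc; _+_; _∸_; _≤_; _<_; _⊓_; _⊔_; z≤n; s≤s; _≤?_; _<?_)
open import Data.Nat.Properties
open import Data.Fin using (Fin; toℕ; fromℕ<)
open import Data.Fin.Properties using (toℕ-injective; toℕ-fromℕ<; toℕ<n; injective⇒≤)
open import Data.Fin.Permutation using (Permutation′; _⟨$⟩ʳ_)
open import Data.Product using (Σ; _×_; _,_; proj₁; proj₂; map₁; map₂; swap)
open import Data.Sum using (_⊎_; inj₁; inj₂; [_,_])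
open import Data.Empty using (⊥)
open import Function using (_∘_)
open import Function.Bundles using (_⇔_; mk⇔; Equivalence; Injection)
open import Function.Properties.Inverse using (↔⇒↣)
open import Relation.Nullary using (¬_; yes; no; contradiction)
open import Relation.Nullary.Decidable using (Dec; map′; decidable-stable; _×-dec_; _⊎-dec_)
open import Relation.Binary.PropositionalEquality
  using (_≡_; _≢_; refl; sym; trans; cong; subst; ≢-sym)

start∈Seg : ∀ h j → h ∈Seg (h , j)
start∈Seg h j = ≤-refl , m≤m+n h j

end∈Seg : ∀ h j → (h + j) ∈Seg (h , j)
end∈Seg h j = m≤m+n h j , ≤-refl

∈Seg-singleton⁻ : ∀ {x y} → x ∈Seg (y , 0) → x ≡ y
∈Seg-singleton⁻ {x} {y} (y≤x , x≤y+0) = ≤-antisym (subst (x ≤_) (+-identityʳ y) x≤y+0) y≤x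

_∈Seg?_ : (x : ℕ) (J : Seg) → Dec (x ∈Seg J)
x ∈Seg? (h , j) = h ≤? x ×-dec x ≤? h + j

∈-one-of : ∀ {x} J₁ J₂ J₃ → (¬ x ∈Seg J₁ → ¬ x ∈Seg J₂ → ¬ x ∈Seg J₃ → ⊥) →
           x ∈Seg J₁ ⊎ x ∈Seg J₂ ⊎ x ∈Seg J₃
∈-one-of {x} J₁ J₂ J₃ gapless =
  decidable-stable (x ∈Seg? J₁ ⊎-dec x ∈Seg? J₂ ⊎-dec x ∈Seg? J₃)
    λ x∉ → gapless (x∉ ∘ inj₁) (x∉ ∘ inj₂ ∘ inj₁) (x∉ ∘ inj₂ ∘ inj₂)

∉Seg-above : ∀ {y l c} → l ≤ y → ¬ y ∈Seg (l , c) → l + c < y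
∉Seg-above l≤y y∉ = ≰⇒> λ y≤ → y∉ (l≤y , y≤)

∉Seg-below : ∀ {y d e} → y ≤ d + e → ¬ y ∈Seg (d , e) → y < d
∉Seg-below y≤ y∉ = ≰⇒> λ d≤y → y∉ (d≤y , y≤)

⊆Seg⇒bounds : ∀ {h j h' j'} → (h , j) ⊆Seg (h' , j') → h' ≤ h × h + j ≤ h' + j'
⊆Seg⇒bounds {h} {j} J⊆K = proj₁ (J⊆K h (start∈Seg h j)) , proj₂ (J⊆K (h + j) (end∈Seg h j))

bounds⇒⊆Seg : ∀ {h j h' j'} → h' ≤ h × h + j ≤ h' + j' → (h , j) ⊆Seg (h' , j')
bounds⇒⊆Seg (h'≤h , e≤e') x (h≤x , x≤e) = ≤-trans h'≤h h≤x , ≤-trans x≤e e≤e'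

_⊆Seg?_ : (J K : Seg) → Dec (J ⊆Seg K)
(h , j) ⊆Seg? (h' , j') = map′ bounds⇒⊆Seg ⊆Seg⇒bounds (h' ≤? h ×-dec h + j ≤? h' + j')

⊆Seg-antisym : ∀ {J K} → J ⊆Seg K → K ⊆Seg J → J ≡ K
⊆Seg-antisym {h , j} {h' , j'} J⊆K K⊆J
  with ≤-antisym (proj₁ (⊆Seg⇒bounds K⊆J)) (proj₁ (⊆Seg⇒bounds J⊆K))
... | refl = cong (h ,_) (+-cancelˡ-≡ h j j'
               (≤-antisym (proj₂ (⊆Seg⇒bounds J⊆K)) (proj₂ (⊆Seg⇒bounds K⊆J))))

⊆Seg⇒length≤ : ∀ {h j h' j'} → (h , j) ⊆Seg (h' , j') → j ≤ j'
⊆Seg⇒length≤ {h} {j} {h'} {j'} J⊆K =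
  +-cancelˡ-≤ h' j j'
    (≤-trans (+-monoˡ-≤ j (proj₁ (⊆Seg⇒bounds J⊆K))) (proj₂ (⊆Seg⇒bounds J⊆K)))

⊂Seg⇒length< : ∀ {h j h' j'} → (h , j) ⊂Seg (h' , j') → j < j'
⊂Seg⇒length< {h} {j} {h'} {j'} (J⊆K , K⊈J) with j <? j'
... | yes j<j' = j<j'
... | no j≮j' = contradiction (bounds⇒⊆Seg (h≤h' , +-mono-≤ h'≤h j'≤j)) K⊈J
  where
  h'≤h : h' ≤ h
  h'≤h = proj₁ (⊆Seg⇒bounds J⊆K)
  j'≤j : j' ≤ j
  j'≤j = ≮⇒≥ j≮j'
  h≤h' : h ≤ h'
  h≤h' = +-cancelʳ-≤ j h h' (≤-trans (proj₂ (⊆Seg⇒bounds J⊆K)) (+-monoʳ-≤ h' j'≤j))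

singleton⊂Seg : ∀ {x a m} → 0 < m → x ∈Seg (a , m) → (x , 0) ⊂Seg (a , m)
singleton⊂Seg 0<m x∈I =
  (λ y y∈ → subst (_∈Seg _) (sym (∈Seg-singleton⁻ y∈)) x∈I) ,
  λ I⊆ → <⇒≱ 0<m (⊆Seg⇒length≤ I⊆)

⊂Seg-misses-endpoint : ∀ {J a m} → J ⊂Seg (a , m) → a ∈Seg J → (a + m) ∈Seg J → ⊥
⊂Seg-misses-endpoint (_ , I⊈J) a∈J b∈J = I⊈J (bounds⇒⊆Seg (proj₁ a∈J , proj₂ b∈J))

-- J and K overlap or are adjacent, so that their union J ∪Seg K is again a segment.
Touch : Seg → Seg → Set
Touch (h , j) (h' , j') = h' ≤ suc (h + j) × h ≤ suc (h' + j')

_Abuts_ : ℕ → Seg → Set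
q Abuts (p , k) = q ≡ suc (p + k) ⊎ suc q ≡ p

∈-both⇒Touch : ∀ {x J K} → x ∈Seg J → x ∈Seg K → Touch J K
∈-both⇒Touch (h≤x , x≤e) (h'≤x , x≤e') =
  ≤-trans h'≤x (m≤n⇒m≤1+n x≤e) , ≤-trans h≤x (m≤n⇒m≤1+n x≤e')

∈-Abuts⇒Touch : ∀ {q J K} → q ∈Seg J → q Abuts K → Touch J K
∈-Abuts⇒Touch {q} {h , j} {p , k} (h≤q , q≤e) (inj₁ refl) =
  ≤-trans (m≤m+n p k) (≤-trans (n≤1+n _) (≤-trans q≤e (n≤1+n _))) , h≤q
∈-Abuts⇒Touch {q} {h , j} {p , k} (h≤q , q≤e) (inj₂ refl) =
  s≤s q≤e , ≤-trans h≤q (≤-trans (n≤1+n q) (≤-trans (m≤m+n (suc q) k) (n≤1+n _)))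

Abuts⇒∉ : ∀ {q P} → q Abuts P → ¬ q ∈Seg P
Abuts⇒∉ (inj₁ refl) (_ , q≤e) = <-irrefl refl q≤e
Abuts⇒∉ (inj₂ refl) (p≤q , _) = <-irrefl refl p≤q

⊂Seg⇒Abuts : ∀ {P Q} → P ⊂Seg Q → Σ ℕ λ q → q ∈Seg Q × q Abuts P
⊂Seg⇒Abuts {p , k} {i , m} (P⊆Q , Q⊈P) with p + k <? i + m | i <? p
... | yes e<e' | _ = suc (p + k) , (≤-trans i≤p (≤-trans (m≤m+n p k) (n≤1+n _)) , e<e') , inj₁ refl
  where
  i≤p : i ≤ p
  i≤p = proj₁ (⊆Seg⇒bounds P⊆Q)
... | no _ | yes (s≤s i≤q) =
  _ , (i≤q , ≤-trans (n≤1+n _) (≤-trans (m≤m+n p k) (proj₂ (⊆Seg⇒bounds P⊆Q)))) , inj₂ refl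
... | no e≮e' | no i≮p = contradiction (bounds⇒⊆Seg (≮⇒≥ i≮p , ≮⇒≥ e≮e')) Q⊈P

_∪Seg_ : Seg → Seg → Seg
(h , j) ∪Seg (h' , j') = h ⊓ h' , ((h + j) ⊔ (h' + j')) ∸ (h ⊓ h')

∪Seg-end : ∀ h j h' j' → h ⊓ h' + (((h + j) ⊔ (h' + j')) ∸ (h ⊓ h')) ≡ (h + j) ⊔ (h' + j')
∪Seg-end h j h' j' = m+[n∸m]≡n (≤-trans (m⊓n≤m h h') (≤-trans (m≤m+n h j) (m≤m⊔n _ _)))

∈-∪Seg⁺ˡ : ∀ {x J K} → x ∈Seg J → x ∈Seg (J ∪Seg K)
∈-∪Seg⁺ˡ {x} {h , j} {h' , j'} (h≤x , x≤e) =
  ≤-trans (m⊓n≤m h h') h≤x , subst (x ≤_) (sym (∪Seg-end h j h' j')) (≤-trans x≤e (m≤m⊔n _ _))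

∈-∪Seg⁺ʳ : ∀ {x J K} → x ∈Seg K → x ∈Seg (J ∪Seg K)
∈-∪Seg⁺ʳ {x} {h , j} {h' , j'} (h'≤x , x≤e') =
  ≤-trans (m⊓n≤n h h') h'≤x , subst (x ≤_) (sym (∪Seg-end h j h' j')) (≤-trans x≤e' (m≤n⊔m _ _))

m⊓n≤o<m⇒n≤o : ∀ m n {o} → m ⊓ n ≤ o → o < m → n ≤ o
m⊓n≤o<m⇒n≤o m n m⊓n≤o o<m with ≤-total m n
... | inj₁ m≤n = contradiction (subst (_≤ _) (m≤n⇒m⊓n≡m m≤n) m⊓n≤o) (<⇒≱ o<m)
... | inj₂ n≤m = subst (_≤ _) (m≥n⇒m⊓n≡n n≤m) m⊓n≤o

m<o≤m⊔n⇒o≤n : ∀ m n {o} → m < o → o ≤ m ⊔ n → o ≤ n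
m<o≤m⊔n⇒o≤n m n m<o o≤m⊔n with ≤-total m n
... | inj₁ m≤n = subst (_ ≤_) (m≤n⇒m⊔n≡n m≤n) o≤m⊔n
... | inj₂ n≤m = contradiction (subst (_ ≤_) (m≥n⇒m⊔n≡m n≤m) o≤m⊔n) (<⇒≱ m<o)

∈-∪Seg⁻ : ∀ {x J K} → Touch J K → x ∈Seg (J ∪Seg K) → x ∈Seg J ⊎ x ∈Seg K
∈-∪Seg⁻ {x} {h , j} {h' , j'} (h'≤e+1 , h≤e'+1) (lo≤x , x≤hi) with h ≤? x | x ≤? h + j
... | yes h≤x | yes x≤e = inj₁ (h≤x , x≤e)
... | no h≰x | _ =
  inj₂ (m⊓n≤o<m⇒n≤o h h' lo≤x (≰⇒> h≰x) , ≤-pred (≤-trans (≰⇒> h≰x) h≤e'+1))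
... | yes _ | no x≰e =
  inj₂ (≤-trans h'≤e+1 (≰⇒> x≰e) ,
        m<o≤m⊔n⇒o≤n (h + j) (h' + j') (≰⇒> x≰e) (subst (x ≤_) (∪Seg-end h j h' j') x≤hi))

∪Seg-least : ∀ {J K I} → J ⊆Seg I → K ⊆Seg I → (J ∪Seg K) ⊆Seg I
∪Seg-least {h , j} {h' , j'} {a , m} J⊆I K⊆I =
  bounds⇒⊆Seg (⊓-glb (proj₁ (⊆Seg⇒bounds J⊆I)) (proj₁ (⊆Seg⇒bounds K⊆I)) ,
               subst (_≤ a + m) (sym (∪Seg-end h j h' j'))
                 (⊔-lub (proj₂ (⊆Seg⇒bounds J⊆I)) (proj₂ (⊆Seg⇒bounds K⊆I))))

injection⇒≤ : ∀ {a lo b} (f : Fin (suc a) → ℕ) → (∀ x → f x ∈Seg (lo , b)) →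
              (∀ {x y} → f x ≡ f y → x ≡ y) → a ≤ b
injection⇒≤ {a} {lo} {b} f f∈ f-injective = ≤-pred (injective⇒≤ offset-injective)
  where
  offset : Fin (suc a) → Fin (suc b)
  offset x = fromℕ< (s≤s (m≤n+o⇒m∸n≤o (f x) lo (proj₂ (f∈ x))))
  offset-injective : ∀ {x y} → offset x ≡ offset y → x ≡ y
  offset-injective {x} {y} eq = f-injective (∸-cancelʳ-≡ (proj₁ (f∈ x)) (proj₁ (f∈ y))
    (trans (sym (toℕ-fromℕ< _)) (trans (cong toℕ eq) (toℕ-fromℕ< _))))

module _ {n : ℕ} (w : Permutation′ n) where

  val : Fin n → ℕ
  val t = toℕ (w ⟨$⟩ʳ t)

  val-injective : ∀ {t t'} → val t ≡ val t' → t ≡ t'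
  val-injective eq = Injection.injective (↔⇒↣ w) (toℕ-injective eq)

  -- IsInterval w (h , j) unfolds to Σ ℕ λ i → i + j < n × MapsOnto (i , j) (h , j).
  MapsOnto : Seg → Seg → Set
  MapsOnto P V = ∀ v → v ∈Seg V ⇔ (Σ (Fin n) λ t → toℕ t ∈Seg P × val t ≡ v)

  positions : ∀ {V} → IsInterval w V → Seg
  positions {_ , j} (i , _) = i , j

  val∈ : ∀ {V t} (X : IsInterval w V) → toℕ t ∈Seg positions X → val t ∈Seg V
  val∈ {_} {t} (_ , _ , onto) t∈P = Equivalence.from (onto (val t)) (t , t∈P , refl)

  pos∈ : ∀ {V t} (X : IsInterval w V) → val t ∈Seg V → toℕ t ∈Seg positions X
  pos∈ {_ , j} {t} (i , _ , onto) v∈V with Equivalence.to (onto (val t)) v∈V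
  ... | t' , t'∈P , eq = subst (λ s → toℕ s ∈Seg (i , j)) (val-injective eq) t'∈P

  MapsOnto⇒length≡ : ∀ {p k h k'} → p + k < n → MapsOnto (p , k) (h , k') → k ≡ k'
  MapsOnto⇒length≡ {p} {k} {h} {k'} end<n onto =
    ≤-antisym (injection⇒≤ value value∈ value-injective)
              (injection⇒≤ position position∈ position-injective)
    where
    at : Fin (suc k) → Fin n
    at x = fromℕ< (≤-<-trans (+-monoʳ-≤ p (≤-pred (toℕ<n x))) end<n)
    toℕ-at : ∀ x → toℕ (at x) ≡ p + toℕ x
    toℕ-at x = toℕ-fromℕ< _
    value : Fin (suc k) → ℕ
    value x = val (at x)
    value∈ : ∀ x → value x ∈Seg (h , k')
    value∈ x = Equivalence.from (onto _)
      (at x , subst (_∈Seg (p , k)) (sym (toℕ-at x)) (m≤m+n p _ , +-monoʳ-≤ p (≤-pred (toℕ<n x))) , refl)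
    value-injective : ∀ {x y} → value x ≡ value y → x ≡ y
    value-injective {x} {y} eq = toℕ-injective (+-cancelˡ-≡ p _ _
      (trans (sym (toℕ-at x)) (trans (cong toℕ (val-injective eq)) (toℕ-at y))))
    preimage : (y : Fin (suc k')) → Σ (Fin n) λ t → toℕ t ∈Seg (p , k) × val t ≡ h + toℕ y
    preimage y = Equivalence.to (onto _) (m≤m+n h _ , +-monoʳ-≤ h (≤-pred (toℕ<n y)))
    position : Fin (suc k') → ℕ
    position y = toℕ (proj₁ (preimage y))
    position∈ : ∀ y → position y ∈Seg (p , k)
    position∈ y = proj₁ (proj₂ (preimage y))
    position-injective : ∀ {x y} → position x ≡ position y → x ≡ y
    position-injective {x} {y} eq = toℕ-injective (+-cancelˡ-≡ h _ _
      (trans (sym (proj₂ (proj₂ (preimage x))))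
        (trans (cong val (toℕ-injective eq)) (proj₂ (proj₂ (preimage y))))))

  MapsOnto⇒IsInterval : ∀ {p k h k'} → p + k < n → MapsOnto (p , k) (h , k') → IsInterval w (h , k')
  MapsOnto⇒IsInterval end<n onto with MapsOnto⇒length≡ end<n onto
  ... | refl = _ , end<n , onto

  MapsOnto-∪ : ∀ {P P' V V'} → Touch P P' → Touch V V' → MapsOnto P V → MapsOnto P' V' →
               MapsOnto (P ∪Seg P') (V ∪Seg V')
  MapsOnto-∪ {P} {P'} {V} {V'} P⌣P' V⌣V' onto onto' v = mk⇔ to from
    where
    to : v ∈Seg (V ∪Seg V') → Σ (Fin n) λ t → toℕ t ∈Seg (P ∪Seg P') × val t ≡ v
    to v∈ with ∈-∪Seg⁻ V⌣V' v∈
    ... | inj₁ v∈V = map₂ (map₁ ∈-∪Seg⁺ˡ) (Equivalence.to (onto v) v∈V)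
    ... | inj₂ v∈V' = map₂ (map₁ ∈-∪Seg⁺ʳ) (Equivalence.to (onto' v) v∈V')
    from : (Σ (Fin n) λ t → toℕ t ∈Seg (P ∪Seg P') × val t ≡ v) → v ∈Seg (V ∪Seg V')
    from (t , t∈ , refl) with ∈-∪Seg⁻ P⌣P' t∈
    ... | inj₁ t∈P = ∈-∪Seg⁺ˡ (Equivalence.from (onto _) (t , t∈P , refl))
    ... | inj₂ t∈P' = ∈-∪Seg⁺ʳ (Equivalence.from (onto' _) (t , t∈P' , refl))

  IsInterval-∪ : ∀ {V V'} (X : IsInterval w V) (Y : IsInterval w V') →
                 Touch V V' → Touch (positions X) (positions Y) → IsInterval w (V ∪Seg V')
  IsInterval-∪ {_ , j} {_ , j'} (i , i+j<n , onto) (i' , i'+j'<n , onto') V⌣V' P⌣P' =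
    MapsOnto⇒IsInterval (subst (_< n) (sym (∪Seg-end i j i' j')) (⊔-lub i+j<n i'+j'<n))
                        (MapsOnto-∪ P⌣P' V⌣V' onto onto')

  IsInterval-∪-meet : ∀ {x V V'} → IsInterval w V → IsInterval w V' →
                      x ∈Seg V → x ∈Seg V' → IsInterval w (V ∪Seg V')
  IsInterval-∪-meet X@(_ , _ , onto) Y x∈V x∈V' with Equivalence.to (onto _) x∈V
  ... | t , t∈P , refl = IsInterval-∪ X Y (∈-both⇒Touch x∈V x∈V') (∈-both⇒Touch t∈P (pos∈ Y x∈V'))

  IsInterval-singleton : ∀ t → IsInterval w (val t , 0)
  IsInterval-singleton t = toℕ t , subst (_< n) (sym (+-identityʳ _)) (toℕ<n t) , onto
    where
    onto : MapsOnto (toℕ t , 0) (val t , 0)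
    onto v = mk⇔ (λ v∈ → t , start∈Seg _ 0 , sym (∈Seg-singleton⁻ v∈))
                 λ { (t' , t'∈ , refl) → subst (λ s → val s ∈Seg (val t , 0))
                                           (sym (toℕ-injective (∈Seg-singleton⁻ t'∈))) (start∈Seg _ 0) }

  positions-mono : ∀ {K V} (X : IsInterval w K) (Y : IsInterval w V) →
                   K ⊆Seg V → positions X ⊆Seg positions Y
  positions-mono X@(_ , end<n , _) Y K⊆V q q∈P =
    subst (_∈Seg positions Y) (toℕ-fromℕ< q<n)
      (pos∈ Y (K⊆V _ (val∈ X (subst (_∈Seg positions X) (sym (toℕ-fromℕ< q<n)) q∈P))))
    where
    q<n : q < n
    q<n = ≤-<-trans (proj₂ q∈P) end<n

  ⊂⇒abutting-position : ∀ {K V} (X : IsInterval w K) (Y : IsInterval w V) → K ⊂Seg V →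
                        Σ (Fin n) λ t → val t ∈Seg V × toℕ t Abuts positions X
  ⊂⇒abutting-position X Y@(_ , end<n , _) K⊂V@(K⊆V , _)
    with ⊂Seg⇒Abuts (positions-mono X Y K⊆V ,
                     λ PY⊆PX → <⇒≱ (⊂Seg⇒length< K⊂V) (⊆Seg⇒length≤ PY⊆PX))
  ... | q , q∈PY , q-abuts = t , val∈ Y (subst (_∈Seg positions Y) (sym toℕ-t) q∈PY)
                              , subst (_Abuts positions X) (sym toℕ-t) q-abuts
    where
    q<n : q < n
    q<n = ≤-<-trans (proj₂ q∈PY) end<n
    t : Fin n
    t = fromℕ< q<n
    toℕ-t : toℕ t ≡ q
    toℕ-t = toℕ-fromℕ< q<n

module _ {n : ℕ} (w : Permutation′ n) {a m : ℕ} where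

  Covers-⊆⇒≡ : ∀ {J K} → Covers w (a , m) J → Covers w (a , m) K → J ⊆Seg K → J ≡ K
  Covers-⊆⇒≡ {J} {K} (_ , _ , nothing-between) (K-int , K⊂I , _) J⊆K =
    ⊆Seg-antisym J⊆K (decidable-stable (K ⊆Seg? J)
      λ K⊈J → nothing-between (K , K-int , (J⊆K , K⊈J) , K⊂I))

  Covers⇒⊆∪ : ∀ {J K} → Covers w (a , m) J → K ⊆Seg (a , m) → IsInterval w (J ∪Seg K) → ¬ K ⊆Seg J →
              (a , m) ⊆Seg (J ∪Seg K)
  Covers⇒⊆∪ {J} {K} (_ , (J⊆I , _) , nothing-between) K⊆I J∪K-int K⊈J =
    decidable-stable ((a , m) ⊆Seg? (J ∪Seg K)) λ I⊈J∪K →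
      nothing-between (J ∪Seg K , J∪K-int ,
        ((λ _ → ∈-∪Seg⁺ˡ) , λ J∪K⊆J → K⊈J λ x → J∪K⊆J x ∘ ∈-∪Seg⁺ʳ) ,
        (∪Seg-least J⊆I K⊆I , I⊈J∪K))

  meeting-Covers-span : ∀ {x J K} → Covers w (a , m) J → Covers w (a , m) K → J ≢ K →
                        x ∈Seg J → x ∈Seg K → ∀ {y} → y ∈Seg (a , m) → y ∈Seg J ⊎ y ∈Seg K
  meeting-Covers-span cJ@(J-int , _) cK@(K-int , (K⊆I , _) , _) J≢K x∈J x∈K y∈I =
    ∈-∪Seg⁻ (∈-both⇒Touch x∈J x∈K)
      (Covers⇒⊆∪ cJ K⊆I (IsInterval-∪-meet w J-int K-int x∈J x∈K)
                 (λ K⊆J → J≢K (sym (Covers-⊆⇒≡ cK cJ K⊆J))) _ y∈I)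

  ¬¬Covers-above : ∀ fuel {K} → IsInterval w K → K ⊂Seg (a , m) → m ≤ proj₂ K + fuel →
                   ¬ ¬ (Σ Seg λ J → Covers w (a , m) J × K ⊆Seg J)
  ¬¬Covers-above 0 K-int K⊂I m≤k+0 _ = <⇒≱ (⊂Seg⇒length< K⊂I) (subst (m ≤_) (+-identityʳ _) m≤k+0)
  ¬¬Covers-above (suc fuel) {K} K-int K⊂I m≤k+1+fuel no-cover =
    no-cover (K , (K-int , K⊂I , nothing-between) , λ _ x∈K → x∈K)
    where
    nothing-between : ¬ (Σ Seg λ K' → IsInterval w K' × K ⊂Seg K' × K' ⊂Seg (a , m))
    nothing-between (K' , K'-int , K⊂K' , K'⊂I) =
      ¬¬Covers-above fuel K'-int K'⊂I
        (≤-trans m≤k+1+fuel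
          (≤-trans (≤-reflexive (+-suc (proj₂ K) fuel)) (+-monoˡ-≤ fuel (⊂Seg⇒length< K⊂K'))))
        λ (J , cJ , K'⊆J) → no-cover (J , cJ , λ x → K'⊆J x ∘ proj₁ K⊂K' x)

  ¬¬Covers-containing : 0 < m → IsInterval w (a , m) → ∀ {x} → x ∈Seg (a , m) →
                        ¬ ¬ (Σ Seg λ J → Covers w (a , m) J × x ∈Seg J)
  ¬¬Covers-containing 0<m (_ , _ , onto) x∈I no-cover with Equivalence.to (onto _) x∈I
  ... | t , _ , refl = ¬¬Covers-above m (IsInterval-singleton w t) (singleton⊂Seg 0<m x∈I) ≤-refl
                         λ (J , cJ , t⊆J) → no-cover (J , cJ , t⊆J _ (start∈Seg _ 0))

module _ {n : ℕ} (w : Permutation′ n) {a m : ℕ} (I-int : IsInterval w (a , m)) where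

  no-cover-triple-with-endpoints :
    ∀ {L M R} → Covers w (a , m) L → Covers w (a , m) M → Covers w (a , m) R → L ≢ M → M ≢ R →
    a ∈Seg L → (a + m) ∈Seg R →
    (∀ x → x ∈Seg (a , m) → ¬ x ∈Seg L → ¬ x ∈Seg M → ¬ x ∈Seg R → ⊥) → ⊥
  no-cover-triple-with-endpoints {l , c} {h , k} {d , e}
    cL@(L-int , L⊂I , _) cM@(M-int , M⊂I@(M⊆I , _) , _) cR@(R-int , R⊂I , _) L≢M M≢R a∈L b∈R gapless =
    absurd-at (⊂⇒abutting-position w M-int I-int M⊂I)
    where
    covered : ∀ {x} → x ∈Seg (a , m) → x ∈Seg (l , c) ⊎ x ∈Seg (h , k) ⊎ x ∈Seg (d , e)
    covered x∈I = ∈-one-of (l , c) (h , k) (d , e) (gapless _ x∈I)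

    a∈I : a ∈Seg (a , m)
    a∈I = start∈Seg a m
    b∈I : (a + m) ∈Seg (a , m)
    b∈I = end∈Seg a m
    h∈M : h ∈Seg (h , k)
    h∈M = start∈Seg h k
    a≤h : a ≤ h
    a≤h = proj₁ (M⊆I h h∈M)
    h+k≤b : h + k ≤ a + m
    h+k≤b = proj₂ (M⊆I _ (end∈Seg h k))

    b∉L : ¬ (a + m) ∈Seg (l , c)
    b∉L = ⊂Seg-misses-endpoint L⊂I a∈L
    a∉R : ¬ a ∈Seg (d , e)
    a∉R a∈R = ⊂Seg-misses-endpoint R⊂I a∈R b∈R

    L∩M≡∅ : ∀ {x} → x ∈Seg (l , c) → ¬ x ∈Seg (h , k)
    L∩M≡∅ x∈L x∈M with meeting-Covers-span w cL cM L≢M x∈L x∈M b∈I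
    ... | inj₁ b∈L = b∉L b∈L
    ... | inj₂ b∈M with meeting-Covers-span w cM cR M≢R b∈M b∈R a∈I
    ...   | inj₁ a∈M = ⊂Seg-misses-endpoint M⊂I a∈M b∈M
    ...   | inj₂ a∈R = a∉R a∈R

    M∩R≡∅ : ∀ {x} → x ∈Seg (h , k) → ¬ x ∈Seg (d , e)
    M∩R≡∅ x∈M x∈R with meeting-Covers-span w cM cR M≢R x∈M x∈R a∈I
    ... | inj₁ a∈M = L∩M≡∅ a∈L a∈M
    ... | inj₂ a∈R = a∉R a∈R

    h∉L : ¬ h ∈Seg (l , c)
    h∉L h∈L = L∩M≡∅ h∈L h∈M
    L<M : l + c < h
    L<M = ∉Seg-above (≤-trans (proj₁ a∈L) a≤h) h∉L
    M<R : h + k < d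
    M<R = ∉Seg-below (≤-trans h+k≤b (proj₂ b∈R)) (M∩R≡∅ (end∈Seg h k))

    -- The point just past L (resp. M) lies in I, and only M (resp. R) can contain it.
    L⌣M : Touch (l , c) (h , k)
    L⌣M with covered {suc (l + c)} (m≤n⇒m≤1+n (proj₂ a∈L) , ≤-trans L<M (≤-trans (m≤m+n h k) h+k≤b))
    ... | inj₁ next∈L = contradiction next∈L (Abuts⇒∉ (inj₁ refl))
    ... | inj₂ (inj₁ next∈M) =
      proj₁ next∈M , ≤-trans (≤-trans (proj₁ a∈L) a≤h) (≤-trans (m≤m+n h k) (n≤1+n _))
    ... | inj₂ (inj₂ next∈R) =
      contradiction (≤-trans (proj₁ next∈R) (≤-trans L<M (m≤m+n h k))) (<⇒≱ M<R)

    M⌣R : Touch (h , k) (d , e)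
    M⌣R with covered {suc (h + k)} (≤-trans a≤h (≤-trans (m≤m+n h k) (n≤1+n _)) , ≤-trans M<R (proj₁ b∈R))
    ... | inj₁ next∈L = contradiction (m≤m+n h k) (<⇒≱ (≤-trans (proj₂ next∈L) (<⇒≤ L<M)))
    ... | inj₂ (inj₁ next∈M) = contradiction next∈M (Abuts⇒∉ (inj₁ refl))
    ... | inj₂ (inj₂ next∈R) =
      proj₁ next∈R , ≤-trans (<⇒≤ (≤-<-trans (m≤m+n h k) M<R)) (≤-trans (m≤m+n d e) (n≤1+n _))

    merged-cover-fills : ∀ {J} (cJ : Covers w (a , m) J) → Touch J (h , k) →
                         Touch (positions w (proj₁ cJ)) (positions w M-int) → ¬ h ∈Seg J →
                         ∀ {z} → z ∈Seg (a , m) → ¬ z ∈Seg J → ¬ z ∈Seg (h , k) → ⊥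
    merged-cover-fills cJ@(J-int , _) J⌣M PJ⌣PM h∉J z∈I z∉J z∉M =
      [ z∉J , z∉M ] (∈-∪Seg⁻ J⌣M
        (Covers⇒⊆∪ w cJ M⊆I (IsInterval-∪ w J-int M-int J⌣M PJ⌣PM) (λ M⊆J → h∉J (M⊆J h h∈M)) _ z∈I))

    absurd-at : (Σ (Fin n) λ t → val w t ∈Seg (a , m) × toℕ t Abuts positions w M-int) → ⊥
    absurd-at (t , v∈I , t-abuts) with covered v∈I
    ... | inj₁ v∈L = merged-cover-fills cL L⌣M (∈-Abuts⇒Touch (pos∈ w L-int v∈L) t-abuts)
                       h∉L b∈I b∉L (λ b∈M → M∩R≡∅ b∈M b∈R)
    ... | inj₂ (inj₁ v∈M) = Abuts⇒∉ t-abuts (pos∈ w M-int v∈M)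
    ... | inj₂ (inj₂ v∈R) = merged-cover-fills cR (swap M⌣R) (∈-Abuts⇒Touch (pos∈ w R-int v∈R) t-abuts)
                              (λ h∈R → M∩R≡∅ h∈M h∈R) a∈I a∉R (L∩M≡∅ a∈L)

  no-cover-triple : ∀ {J₁ J₂ J₃} →
    Covers w (a , m) J₁ → Covers w (a , m) J₂ → Covers w (a , m) J₃ → J₁ ≢ J₂ → J₁ ≢ J₃ → J₂ ≢ J₃ →
    (∀ x → x ∈Seg (a , m) → ¬ x ∈Seg J₁ → ¬ x ∈Seg J₂ → ¬ x ∈Seg J₃ → ⊥) → ⊥
  no-cover-triple {J₁} {J₂} {J₃} c₁ c₂ c₃ J₁≢J₂ J₁≢J₃ J₂≢J₃ gapless =
    endpoints (∈-one-of J₁ J₂ J₃ (gapless a (start∈Seg a m)))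
              (∈-one-of J₁ J₂ J₃ (gapless (a + m) (end∈Seg a m)))
    where
    endpoints : a ∈Seg J₁ ⊎ a ∈Seg J₂ ⊎ a ∈Seg J₃ →
                (a + m) ∈Seg J₁ ⊎ (a + m) ∈Seg J₂ ⊎ (a + m) ∈Seg J₃ → ⊥
    endpoints (inj₁ a∈J₁) (inj₁ b∈J₁) = ⊂Seg-misses-endpoint (proj₁ (proj₂ c₁)) a∈J₁ b∈J₁
    endpoints (inj₂ (inj₁ a∈J₂)) (inj₂ (inj₁ b∈J₂)) = ⊂Seg-misses-endpoint (proj₁ (proj₂ c₂)) a∈J₂ b∈J₂
    endpoints (inj₂ (inj₂ a∈J₃)) (inj₂ (inj₂ b∈J₃)) = ⊂Seg-misses-endpoint (proj₁ (proj₂ c₃)) a∈J₃ b∈J₃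
    endpoints (inj₁ a∈J₁) (inj₂ (inj₁ b∈J₂)) =
      no-cover-triple-with-endpoints c₁ c₃ c₂ J₁≢J₃ (≢-sym J₂≢J₃) a∈J₁ b∈J₂
        λ x x∈I ∉₁ ∉₃ ∉₂ → gapless x x∈I ∉₁ ∉₂ ∉₃
    endpoints (inj₁ a∈J₁) (inj₂ (inj₂ b∈J₃)) =
      no-cover-triple-with-endpoints c₁ c₂ c₃ J₁≢J₂ J₂≢J₃ a∈J₁ b∈J₃ gapless
    endpoints (inj₂ (inj₁ a∈J₂)) (inj₁ b∈J₁) =
      no-cover-triple-with-endpoints c₂ c₃ c₁ J₂≢J₃ (≢-sym J₁≢J₃) a∈J₂ b∈J₁
        λ x x∈I ∉₂ ∉₃ ∉₁ → gapless x x∈I ∉₁ ∉₂ ∉₃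
    endpoints (inj₂ (inj₁ a∈J₂)) (inj₂ (inj₂ b∈J₃)) =
      no-cover-triple-with-endpoints c₂ c₁ c₃ (≢-sym J₁≢J₂) J₁≢J₃ a∈J₂ b∈J₃
        λ x x∈I ∉₂ ∉₁ ∉₃ → gapless x x∈I ∉₁ ∉₂ ∉₃
    endpoints (inj₂ (inj₂ a∈J₃)) (inj₁ b∈J₁) =
      no-cover-triple-with-endpoints c₃ c₂ c₁ (≢-sym J₂≢J₃) (≢-sym J₁≢J₂) a∈J₃ b∈J₁
        λ x x∈I ∉₃ ∉₂ ∉₁ → gapless x x∈I ∉₁ ∉₂ ∉₃
    endpoints (inj₂ (inj₂ a∈J₃)) (inj₂ (inj₁ b∈J₂)) =
      no-cover-triple-with-endpoints c₃ c₁ c₂ (≢-sym J₁≢J₃) J₁≢J₂ a∈J₃ b∈J₂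
        λ x x∈I ∉₃ ∉₁ ∉₂ → gapless x x∈I ∉₁ ∉₂ ∉₃

corollary3p8 : (n : ℕ) (w : Permutation′ n) (I : Seg) →
    IsInterval w I → ¬ CoversExactlyThree w I
corollary3p8 n w (a , m) I-int (J₁ , J₂ , J₃ , c₁ , c₂ , c₃ , J₁≢J₂ , J₁≢J₃ , J₂≢J₃ , only-these) =
  no-cover-triple w I-int c₁ c₂ c₃ J₁≢J₂ J₁≢J₃ J₂≢J₃ gapless
  where
  0<m : 0 < m
  0<m = ≤-<-trans z≤n (⊂Seg⇒length< (proj₁ (proj₂ c₁)))
  gapless : ∀ x → x ∈Seg (a , m) → ¬ x ∈Seg J₁ → ¬ x ∈Seg J₂ → ¬ x ∈Seg J₃ → ⊥
  gapless x x∈I x∉J₁ x∉J₂ x∉J₃ =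
    ¬¬Covers-containing w 0<m I-int x∈I λ (J , cJ , x∈J) → not-one-of (only-these J cJ) x∈J
    where
    not-one-of : ∀ {J} → J ≡ J₁ ⊎ J ≡ J₂ ⊎ J ≡ J₃ → ¬ x ∈Seg J
    not-one-of (inj₁ refl) = x∉J₁
    not-one-of (inj₂ (inj₁ refl)) = x∉J₂
    not-one-of (inj₂ (inj₂ refl)) = x∉J₃
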